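{- Let $G$ be a simple graph with vertex set $V$ and let $F$ be the mixed graph obtained from $G$ by replacing each edge $uv$ with $d_G(u)>d_G(v)$ by the arc $\overrightarrow{uv}$ and keeping each edge $uv$ with $d_G(u)=d_G(v)$ as an undirected edge. Let $Y$ be the set of vertices $y$ with $d_F^+(y) < d_F^-(y)$. If $u,w \in V$ and $v \in Y$ are such that $\overrightarrow{uv}$ and $\overrightarrow{vw}$ are arcs of $F$ and $uw \notin E(G)$, then $cM_{2}(G-uv-vw+uw) > cM_{2}(G)$.
   Context: All graphs are finite and simple. $cM_{2}(G)=\sum_{uv \in E(G)} |d_{G}(u)^{2}-d_{G}(v)^{2}|$, where $d_G$ is the degree in $G$. In the mixed graph $F$, $d_F^+(x)$ is the number of arcs with tail $x$ and $d_F^-(x)$ is the number of arcs with head $x$ (undirected edges are not counted in either). $G-uv-vw+uw$ is the graph obtained from $G$ by deleting the edges $uv$, $vw$ and adding the edge $uw$. -}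

module Defs where

open import Data.Nat using (ℕ; _+_; _^_; _<_; ∣_-_∣)
open import Data.Nat.Properties using (_<?_)
open import Data.Bool using (Bool; true; false; if_then_else_; _∧_; _∨_; T)
open import Data.Fin using (Fin; toℕ; _≟_)
open import Data.List using (List; map; allFin)
open import Data.Nat.ListAction using (sum)
open import Relation.Nullary.Decidable using (⌊_⌋)
open import Relation.Binary.PropositionalEquality using (_≡_)

record Graph (n : ℕ) : Set where
  field
    adj     : Fin n → Fin n → Bool
    adj-sym : ∀ x y → adj x y ≡ adj y x
    adj-irr : ∀ x → adj x x ≡ false
open Graph public

Σv : ∀ {n} → (Fin n → ℕ) → ℕ
Σv {n} f = sum (map f (allFin n))

count : ∀ {n} → (Fin n → Bool) → ℕ
count p = Σv (λ j → if p j then 1 else 0)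

deg : ∀ {n} → Graph n → Fin n → ℕ
deg G x = count (adj G x)

arcF : ∀ {n} → Graph n → Fin n → Fin n → Bool
arcF G x y = adj G x y ∧ ⌊ deg G y <? deg G x ⌋

outdegF : ∀ {n} → Graph n → Fin n → ℕ
outdegF G x = count (λ y → arcF G x y)

indegF : ∀ {n} → Graph n → Fin n → ℕ
indegF G x = count (λ y → arcF G y x)

InY : ∀ {n} → Graph n → Fin n → Set
InY G y = outdegF G y < indegF G y

cM2 : ∀ {n} → Graph n → ℕ
cM2 G = Σv (λ i → Σv (λ j →
  if adj G i j ∧ ⌊ toℕ i <? toℕ j ⌋
  then ∣ deg G i ^ 2 - deg G j ^ 2 ∣ else 0))

samePair : ∀ {n} → Fin n → Fin n → Fin n → Fin n → Bool
samePair a b x y = (⌊ x ≟ a ⌋ ∧ ⌊ y ≟ b ⌋) ∨ (⌊ x ≟ b ⌋ ∧ ⌊ y ≟ a ⌋)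

moveAdj : ∀ {n} → Graph n → Fin n → Fin n → Fin n → Fin n → Fin n → Bool
moveAdj G u v w x y =
  if samePair u w x y then true
  else if samePair u v x y ∨ samePair v w x y then false
  else adj G x y

-- Only the degree of v changes: it drops by 2, since u trades its neighbour v for w and w
-- trades v for u. Put D = d(v)² − d'(v)² > 0. A remaining edge vx gains exactly D when
-- d(x) > d(v), loses at most D when d(x) < d(v) and loses nothing when d(x) = d(v), while
-- the new edge uw weighs d(u)² − d(w)², the total weight of the deleted edges uv and vw.
-- So cM₂ grows by at least D (d⁻_F(v) − d⁺_F(v)) > 0. To stay within ℕ the comparison is
-- made pair by pair: old weight plus a credit is at most new weight plus a debit, where the
-- credits and debits live on the pairs through v and on uw, and the credits sum to more.

module Submission where

open import Data.Bool using (Bool; true; false; if_then_else_; _∧_; _∨_)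
open import Data.Bool.Properties
  using (∨-comm; ∧-comm; ∧-zeroʳ; ∨-identityʳ; if-float; if-cong; if-cong₂; if-cong-then; if-cong-else; if-swap-then; if-∧)
open import Data.Fin using (Fin; zero; suc; toℕ; _≟_)
import Data.Fin.Permutation as Perm
import Data.Fin.Permutation.Components as PC
open import Data.Fin.Properties using (toℕ-injective; suc-injective)
open import Data.List using (map; tabulate)
open import Data.List.Properties using (map-tabulate)
open import Data.Nat using (ℕ; zero; suc; NonZero; >-nonZero; _+_; _*_; _∸_; _^_; _≤_; _<_; ∣_-_∣; z≤n; z<s; _<?_)
import Data.Nat.ListAction as List
open import Data.Nat.Properties
  using ( +-*-semiring; +-comm; +-identityʳ; *-identityʳ; *-zeroʳ; +-∸-assoc; m∸n+n≡m
        ; +-mono-≤; +-monoˡ-≤; +-monoʳ-≤; +-monoʳ-<; *-monoʳ-<; +-cancelʳ-<; ^-monoˡ-≤; ^-monoˡ-<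
        ; m≤m+n; m≤n+m; m<m+n; m<n⇒0<n∸m; ≤-trans; ≤-reflexive; ≤-antisym; <⇒≤; <⇒≢; <-asym; <-cmp; ≮⇒≥; n≮n
        ; ∣-∣-comm; ∣-∣-triangle; ∣n-n∣≡0; m≤n⇒∣m-n∣≡n∸m; m≤n⇒∣n-m∣≡n∸m; module ≤-Reasoning)
open import Data.Nat.Tactic.RingSolver using (solve-∀)
open import Algebra.Properties.Semiring.Sum +-*-semiring
  using (sum; sum-cong-≗; sum-replicate-zero; ∑-distrib-+; ∑-comm; *-distribˡ-sum; sum-permute)
open import Data.Product using (_×_; _,_; proj₁; proj₂)
open import Data.Sum using (_⊎_; inj₁; inj₂)
open import Function using (_∘_; id; case_of_)
open import Relation.Binary using (tri<; tri≈; tri>)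
open import Relation.Binary.PropositionalEquality
open import Relation.Nullary using (Dec; yes; no; ¬_; contradiction)
open import Relation.Nullary.Decidable using (⌊_⌋; isYes≗does; dec-true; dec-false; ⌊⌋-map′)

open import Defs

private
  variable
    n : ℕ

⌊⌋-true : {A : Set} (a? : Dec A) → A → ⌊ a? ⌋ ≡ true
⌊⌋-true a? a = trans (isYes≗does a?) (dec-true a? a)

⌊⌋-false : {A : Set} (a? : Dec A) → ¬ A → ⌊ a? ⌋ ≡ false
⌊⌋-false a? ¬a = trans (isYes≗does a?) (dec-false a? ¬a)

if-+ : ∀ b {x y : ℕ} → (if b then x + y else 0) ≡ (if b then x else 0) + (if b then y else 0)
if-+ true  = refl
if-+ false = refl

if-disjoint-∨ : ∀ s A {x : ℕ} → (s ≡ true → A ≡ false) →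
  (if (if s then true else A) then x else 0) ≡ (if A then x else 0) + (if s then x else 0)
if-disjoint-∨ true  A s⇒¬A rewrite s⇒¬A refl = refl
if-disjoint-∨ false A s⇒¬A = sym (+-identityʳ _)

-- Sums over vertices

Σv≡sum : (f : Fin n → ℕ) → Σv f ≡ sum f
Σv≡sum {zero}  f = refl
Σv≡sum {suc n} f = cong (f zero +_) (begin
  List.sum (map f (tabulate suc))           ≡⟨ cong List.sum (map-tabulate suc f) ⟩
  List.sum (tabulate (f ∘ suc))             ≡⟨ cong List.sum (map-tabulate id (f ∘ suc)) ⟨
  Σv (f ∘ suc)                              ≡⟨ Σv≡sum (f ∘ suc) ⟩
  sum (f ∘ suc)                             ∎)
  where open ≡-Reasoning

indicator : Bool → ℕ
indicator b = if b then 1 else 0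

count≡sum : (p : Fin n → Bool) → count p ≡ sum (indicator ∘ p)
count≡sum p = Σv≡sum (indicator ∘ p)

sum-mono-≤ : {f g : Fin n → ℕ} → (∀ i → f i ≤ g i) → sum f ≤ sum g
sum-mono-≤ {zero}  f≤g = z≤n
sum-mono-≤ {suc n} f≤g = +-mono-≤ (f≤g zero) (sum-mono-≤ (f≤g ∘ suc))

term≤sum : (f : Fin n → ℕ) (i : Fin n) → f i ≤ sum f
term≤sum f zero    = m≤m+n (f zero) _
term≤sum f (suc i) = ≤-trans (term≤sum (f ∘ suc) i) (m≤n+m _ (f zero))

sum-δ : (f : Fin n → ℕ) (a : Fin n) → sum (λ i → if ⌊ i ≟ a ⌋ then f i else 0) ≡ f a
sum-δ {suc n} f zero    = trans (cong (f zero +_) (sum-replicate-zero n)) (+-identityʳ (f zero))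
sum-δ {suc n} f (suc a) = trans
  (sum-cong-≗ (λ i → cong (if_then f (suc i) else 0) (⌊⌋-map′ (cong suc) suc-injective (i ≟ a))))
  (sum-δ (f ∘ suc) a)

sum-if≡*count : (p : Fin n → Bool) (k : ℕ) → sum (λ j → if p j then k else 0) ≡ k * count p
sum-if≡*count p k = begin
  sum (λ j → if p j then k else 0)          ≡⟨ sum-cong-≗ (λ j → k*indicator (p j)) ⟨
  sum (λ j → k * indicator (p j))           ≡⟨ *-distribˡ-sum k (indicator ∘ p) ⟨
  k * sum (indicator ∘ p)                   ≡⟨ cong (k *_) (count≡sum p) ⟨
  k * count p                               ∎
  where
  open ≡-Reasoning
  k*indicator : ∀ b → k * indicator b ≡ (if b then k else 0)
  k*indicator b = trans (if-float (k *_) b) (if-cong₂ b (*-identityʳ k) (*-zeroʳ k))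

count-cong : {p q : Fin n → Bool} → (∀ y → p y ≡ q y) → count p ≡ count q
count-cong {p = p} {q} p≗q = begin
  count p                  ≡⟨ count≡sum p ⟩
  sum (indicator ∘ p)      ≡⟨ sum-cong-≗ (λ y → cong indicator (p≗q y)) ⟩
  sum (indicator ∘ q)      ≡⟨ count≡sum q ⟨
  count q                  ∎
  where open ≡-Reasoning

count-swap : {p q : Fin n → Bool} {a b : Fin n} → ¬ a ≡ b →
             p a ≡ q b → p b ≡ q a → (∀ y → ¬ y ≡ a → ¬ y ≡ b → p y ≡ q y) → count p ≡ count q
count-swap {p = p} {q} {a} {b} a≢b pa≡qb pb≡qa p≗q = begin
  count p                                ≡⟨ count≡sum p ⟩
  sum (indicator ∘ p)                    ≡⟨ sum-permute (indicator ∘ p) (Perm.transpose a b) ⟩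
  sum (indicator ∘ p ∘ PC.transpose a b) ≡⟨ sum-cong-≗ (λ y → cong indicator (swapped y)) ⟩
  sum (indicator ∘ q)                    ≡⟨ count≡sum q ⟨
  count q                                ∎
  where
  open ≡-Reasoning
  swapped : ∀ y → p (PC.transpose a b y) ≡ q y
  swapped y with y ≟ a
  ... | yes refl = pb≡qa
  ... | no y≢a with y ≟ b
  ...   | yes refl = pa≡qb
  ...   | no y≢b = p≗q y y≢a y≢b

-- Sums over pairs i < j

strictUpper : (Fin n → Fin n → ℕ) → Fin n → Fin n → ℕ
strictUpper h i j = if ⌊ toℕ i <? toℕ j ⌋ then h i j else 0

pairSum : (Fin n → Fin n → ℕ) → ℕ
pairSum h = sum λ i → sum (strictUpper h i)

pairSum-+ : (f g : Fin n → Fin n → ℕ) → pairSum (λ i j → f i j + g i j) ≡ pairSum f + pairSum g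
pairSum-+ {n} f g = trans (sum-cong-≗ row-+) (∑-distrib-+ (sum ∘ strictUpper f) (sum ∘ strictUpper g))
  where
  row-+ : ∀ i → sum (strictUpper (λ i j → f i j + g i j) i) ≡ sum (strictUpper f i) + sum (strictUpper g i)
  row-+ i = trans (sum-cong-≗ {n} λ j → if-+ ⌊ toℕ i <? toℕ j ⌋) (∑-distrib-+ (strictUpper f i) (strictUpper g i))

pairSum-mono-≤ : {f g : Fin n → Fin n → ℕ} → (∀ {i j} → toℕ i < toℕ j → f i j ≤ g i j) →
                 pairSum f ≤ pairSum g
pairSum-mono-≤ {f = f} {g} f≤g = sum-mono-≤ λ i → sum-mono-≤ λ j → upper-≤ i j
  where
  upper-≤ : ∀ i j → strictUpper f i j ≤ strictUpper g i j
  upper-≤ i j with toℕ i <? toℕ j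
  ... | yes i<j = f≤g i<j
  ... | no  _   = z≤n

<⇒≤-pairSum : (h : Fin n → Fin n → ℕ) {i j : Fin n} → toℕ i < toℕ j → h i j ≤ pairSum h
<⇒≤-pairSum h {i} {j} i<j = begin
  h i j                        ≡⟨ if-cong (⌊⌋-true (toℕ i <? toℕ j) i<j) ⟨
  strictUpper h i j            ≤⟨ term≤sum (strictUpper h i) j ⟩
  sum (strictUpper h i)        ≤⟨ term≤sum (sum ∘ strictUpper h) i ⟩
  pairSum h                    ∎
  where open ≤-Reasoning

≢⇒≤-pairSum : (h : Fin n → Fin n → ℕ) → (∀ i j → h i j ≡ h j i) → {a b : Fin n} → ¬ a ≡ b → h a b ≤ pairSum h
≢⇒≤-pairSum h h-sym {a} {b} a≢b with <-cmp (toℕ a) (toℕ b)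
... | tri< a<b _ _ = <⇒≤-pairSum h a<b
... | tri≈ _ a≡b _ = contradiction (toℕ-injective a≡b) a≢b
... | tri> _ _ b<a = subst (_≤ pairSum h) (h-sym b a) (<⇒≤-pairSum h b<a)

star : Fin n → (Fin n → ℕ) → Fin n → Fin n → ℕ
star v ℓ i j = (if ⌊ i ≟ v ⌋ then ℓ j else 0) + (if ⌊ j ≟ v ⌋ then ℓ i else 0)

star-sym : (v : Fin n) (ℓ : Fin n → ℕ) (i j : Fin n) → star v ℓ i j ≡ star v ℓ j i
star-sym v ℓ i j = +-comm (if ⌊ i ≟ v ⌋ then ℓ j else 0) _

star-centre : {v j : Fin n} (ℓ : Fin n → ℕ) → ¬ j ≡ v → star v ℓ v j ≡ ℓ j
star-centre {v = v} {j} ℓ j≢v rewrite ⌊⌋-true (v ≟ v) refl | ⌊⌋-false (j ≟ v) j≢v = +-identityʳ (ℓ j)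

star-away : {v i j : Fin n} (ℓ : Fin n → ℕ) → ¬ i ≡ v → ¬ j ≡ v → star v ℓ i j ≡ 0
star-away {v = v} {i} {j} ℓ i≢v j≢v rewrite ⌊⌋-false (i ≟ v) i≢v | ⌊⌋-false (j ≟ v) j≢v = refl

pairSum-star : (v : Fin n) (ℓ : Fin n → ℕ) → ℓ v ≡ 0 → pairSum (star v ℓ) ≡ sum ℓ
pairSum-star {n} v ℓ ℓv≡0 = begin
  pairSum (star v ℓ)                ≡⟨ pairSum-+ from-v to-v ⟩
  pairSum from-v + pairSum to-v     ≡⟨ cong₂ _+_ leaving entering ⟩
  sum above + sum below             ≡⟨ ∑-distrib-+ above below ⟨
  sum (λ x → above x + below x)     ≡⟨ sum-cong-≗ (λ x → either-side x (toℕ v <? toℕ x) (toℕ x <? toℕ v)) ⟩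
  sum ℓ                             ∎
  where
  open ≡-Reasoning
  from-v to-v : Fin n → Fin n → ℕ
  from-v i j = if ⌊ i ≟ v ⌋ then ℓ j else 0
  to-v   i j = if ⌊ j ≟ v ⌋ then ℓ i else 0
  above below : Fin n → ℕ
  above x = if ⌊ toℕ v <? toℕ x ⌋ then ℓ x else 0
  below x = if ⌊ toℕ x <? toℕ v ⌋ then ℓ x else 0
  leaving : pairSum from-v ≡ sum above
  leaving = trans (∑-comm (strictUpper from-v))
                  (sum-cong-≗ λ j → trans (sum-cong-≗ λ i → if-swap-then ⌊ toℕ i <? toℕ j ⌋ ⌊ i ≟ v ⌋)
                                          (sum-δ (λ i → if ⌊ toℕ i <? toℕ j ⌋ then ℓ j else 0) v))
  entering : pairSum to-v ≡ sum below
  entering = sum-cong-≗ λ i → trans (sum-cong-≗ λ j → if-swap-then ⌊ toℕ i <? toℕ j ⌋ ⌊ j ≟ v ⌋)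
                                    (sum-δ (λ j → if ⌊ toℕ i <? toℕ j ⌋ then ℓ i else 0) v)
  either-side : ∀ x (v<x? : Dec (toℕ v < toℕ x)) (x<v? : Dec (toℕ x < toℕ v)) →
                (if ⌊ v<x? ⌋ then ℓ x else 0) + (if ⌊ x<v? ⌋ then ℓ x else 0) ≡ ℓ x
  either-side x (yes v<x) (yes x<v) = contradiction x<v (<-asym v<x)
  either-side x (yes _)   (no _)    = +-identityʳ (ℓ x)
  either-side x (no _)    (yes _)   = refl
  either-side x (no v≮x)  (no x≮v)  =
    sym (trans (cong ℓ (toℕ-injective (≤-antisym (≮⇒≥ v≮x) (≮⇒≥ x≮v)))) ℓv≡0)

samePair-refl : (a b : Fin n) → samePair a b a b ≡ true
samePair-refl a b rewrite ⌊⌋-true (a ≟ a) refl | ⌊⌋-true (b ≟ b) refl = refl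

samePair-sym : (a b x y : Fin n) → samePair a b x y ≡ samePair a b y x
samePair-sym a b x y =
  trans (∨-comm (⌊ x ≟ a ⌋ ∧ ⌊ y ≟ b ⌋) _) (cong₂ _∨_ (∧-comm ⌊ x ≟ b ⌋ _) (∧-comm ⌊ x ≟ a ⌋ _))

samePair-∉ : {a b x y : Fin n} → ¬ x ≡ a → ¬ x ≡ b → samePair a b x y ≡ false
samePair-∉ {a = a} {b} {x} x≢a x≢b rewrite ⌊⌋-false (x ≟ a) x≢a | ⌊⌋-false (x ≟ b) x≢b = refl

samePair-≢fst : {a b x y : Fin n} → ¬ x ≡ a → ¬ y ≡ a → samePair a b x y ≡ false
samePair-≢fst {a = a} {b} {x} {y} x≢a y≢a
  rewrite ⌊⌋-false (x ≟ a) x≢a | ⌊⌋-false (y ≟ a) y≢a = ∧-zeroʳ ⌊ x ≟ b ⌋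

samePair-≢snd : {a b x y : Fin n} → ¬ x ≡ b → ¬ y ≡ b → samePair a b x y ≡ false
samePair-≢snd {a = a} {b} {x} {y} x≢b y≢b
  rewrite ⌊⌋-false (x ≟ b) x≢b | ⌊⌋-false (y ≟ b) y≢b = trans (∨-identityʳ _) (∧-zeroʳ ⌊ x ≟ a ⌋)

samePair⇒ : {a b x y : Fin n} → samePair a b x y ≡ true → (x ≡ a × y ≡ b) ⊎ (x ≡ b × y ≡ a)
samePair⇒ {a = a} {b} {x} {y} with x ≟ a | y ≟ b | x ≟ b | y ≟ a
... | yes x≡a | yes y≡b | _       | _       = λ _ → inj₁ (x≡a , y≡b)
... | _       | _       | yes x≡b | yes y≡a = λ _ → inj₂ (x≡b , y≡a)
... | no _    | _       | no _    | _       = λ ()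
... | no _    | _       | yes _   | no _    = λ ()
... | yes _   | no _    | no _    | _       = λ ()
... | yes _   | no _    | yes _   | no _    = λ ()

m∸n+n∸o≡m∸o : ∀ {m n o} → o ≤ n → n ≤ m → (m ∸ n) + (n ∸ o) ≡ m ∸ o
m∸n+n∸o≡m∸o {m} {n} {o} o≤n n≤m = begin
  (m ∸ n) + (n ∸ o)   ≡⟨ +-∸-assoc (m ∸ n) o≤n ⟨
  (m ∸ n + n) ∸ o     ≡⟨ cong (_∸ o) (m∸n+n≡m n≤m) ⟩
  m ∸ o               ∎
  where open ≡-Reasoning

∣m-o∣≤∣n-o∣+[m∸n] : ∀ {m n} o → n ≤ m → ∣ m - o ∣ ≤ ∣ n - o ∣ + (m ∸ n)
∣m-o∣≤∣n-o∣+[m∸n] {m} {n} o n≤m = begin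
  ∣ m - o ∣               ≤⟨ ∣-∣-triangle m n o ⟩
  ∣ m - n ∣ + ∣ n - o ∣   ≡⟨ +-comm ∣ m - n ∣ ∣ n - o ∣ ⟩
  ∣ n - o ∣ + ∣ m - n ∣   ≡⟨ cong (∣ n - o ∣ +_) (m≤n⇒∣n-m∣≡n∸m n≤m) ⟩
  ∣ n - o ∣ + (m ∸ n)     ∎
  where open ≤-Reasoning

∣m-o∣+[m∸n]≡∣n-o∣ : ∀ {m n o} → n ≤ m → m ≤ o → ∣ m - o ∣ + (m ∸ n) ≡ ∣ n - o ∣
∣m-o∣+[m∸n]≡∣n-o∣ {m} {n} {o} n≤m m≤o = begin
  ∣ m - o ∣ + (m ∸ n)   ≡⟨ cong (_+ (m ∸ n)) (m≤n⇒∣m-n∣≡n∸m m≤o) ⟩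
  (o ∸ m) + (m ∸ n)     ≡⟨ m∸n+n∸o≡m∸o n≤m m≤o ⟩
  o ∸ n                 ≡⟨ m≤n⇒∣m-n∣≡n∸m (≤-trans n≤m m≤o) ⟨
  ∣ n - o ∣             ∎
  where open ≡-Reasoning

lowered-edge-weight : ∀ (A : Bool) {p q m} → m ≤ p ^ 2 →
  (if A then ∣ p ^ 2 - q ^ 2 ∣ else 0) + (if A ∧ ⌊ p <? q ⌋ then p ^ 2 ∸ m else 0)
    ≤ (if A then ∣ m - q ^ 2 ∣ else 0) + (if A ∧ ⌊ q <? p ⌋ then p ^ 2 ∸ m else 0)
lowered-edge-weight false m≤p² = z≤n
lowered-edge-weight true {p} {q} {m} m≤p² with p <? q | q <? p
... | yes p<q | yes q<p = contradiction q<p (<-asym p<q)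
... | yes p<q | no _    = ≤-reflexive (trans (∣m-o∣+[m∸n]≡∣n-o∣ m≤p² (^-monoˡ-≤ 2 (<⇒≤ p<q))) (sym (+-identityʳ _)))
... | no _    | yes _   = ≤-trans (≤-reflexive (+-identityʳ _)) (∣m-o∣≤∣n-o∣+[m∸n] (q ^ 2) m≤p²)
... | no p≮q  | no q≮p  rewrite ≤-antisym (≮⇒≥ p≮q) (≮⇒≥ q≮p) | ∣n-n∣≡0 (p ^ 2) = z≤n

-- Edge weights and arcs of F

weight : Graph n → Fin n → Fin n → ℕ
weight H i j = if adj H i j then ∣ deg H i ^ 2 - deg H j ^ 2 ∣ else 0

weight-sym : (H : Graph n) (i j : Fin n) → weight H i j ≡ weight H j i
weight-sym H i j = trans (if-cong (adj-sym H i j)) (if-cong-then (adj H j i) (∣-∣-comm (deg H i ^ 2) _))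

cM2≡pairSum : (H : Graph n) → cM2 H ≡ pairSum (weight H)
cM2≡pairSum {n} H = trans (Σv≡sum (Σv ∘ edgeTerm)) (sum-cong-≗ λ i →
  trans (Σv≡sum (edgeTerm i)) (sum-cong-≗ λ j →
    trans (if-∧ (adj H i j)) (if-swap-then (adj H i j) ⌊ toℕ i <? toℕ j ⌋)))
  where
  edgeTerm : Fin n → Fin n → ℕ
  edgeTerm i j = if adj H i j ∧ ⌊ toℕ i <? toℕ j ⌋ then ∣ deg H i ^ 2 - deg H j ^ 2 ∣ else 0

arcF⇒ : (H : Graph n) (x y : Fin n) → arcF H x y ≡ true → adj H x y ≡ true × deg H y < deg H x
arcF⇒ H x y with adj H x y | deg H y <? deg H x
... | true  | yes dy<dx = λ _ → refl , dy<dx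
... | true  | no _      = λ ()
... | false | _         = λ ()

arcF-≮ : (H : Graph n) (x y : Fin n) → ¬ deg H y < deg H x → arcF H x y ≡ false
arcF-≮ H x y dy≮dx rewrite ⌊⌋-false (deg H y <? deg H x) dy≮dx = ∧-zeroʳ (adj H x y)

-- Shortcutting the path u v w

module Shortcut {n} (G G' : Graph n) {u v w : Fin n}
  (uv∈G : adj G u v ≡ true) (vw∈G : adj G v w ≡ true) (uw∉G : adj G u w ≡ false)
  (G'≡ : ∀ x y → adj G' x y ≡ moveAdj G u v w x y) where

  u≢v : ¬ u ≡ v
  u≢v refl = case trans (sym uv∈G) (adj-irr G u) of λ ()

  v≢w : ¬ v ≡ w
  v≢w refl = case trans (sym vw∈G) (adj-irr G v) of λ ()

  adj'-uw : adj G' u w ≡ true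
  adj'-uw rewrite G'≡ u w | samePair-refl u w = refl

  u≢w : ¬ u ≡ w
  u≢w refl = case trans (sym adj'-uw) (adj-irr G' u) of λ ()

  adj'-vu : adj G' v u ≡ false
  adj'-vu rewrite G'≡ v u | samePair-∉ {y = u} (u≢v ∘ sym) v≢w
                | samePair-sym u v v u | samePair-refl u v = refl

  adj'-vw : adj G' v w ≡ false
  adj'-vw rewrite G'≡ v w | samePair-∉ {y = w} (u≢v ∘ sym) v≢w
                | samePair-≢fst {b = v} (u≢v ∘ sym) (u≢w ∘ sym) | samePair-refl v w = refl

  adj'-v : ∀ {y} → ¬ y ≡ u → ¬ y ≡ w → adj G' v y ≡ adj G v y
  adj'-v {y} y≢u y≢w rewrite G'≡ v y | samePair-∉ {y = y} (u≢v ∘ sym) v≢w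
                       | samePair-≢fst {b = v} (u≢v ∘ sym) y≢u | samePair-≢snd {a = v} v≢w y≢w = refl

  adj'-∉ : ∀ {x y} → ¬ x ≡ u → ¬ x ≡ v → ¬ x ≡ w → adj G' x y ≡ adj G x y
  adj'-∉ {x} {y} x≢u x≢v x≢w rewrite G'≡ x y | samePair-∉ {y = y} x≢u x≢w
                                   | samePair-∉ {y = y} x≢u x≢v | samePair-∉ {y = y} x≢v x≢w = refl

  adj'-≢v : ∀ {x y} → ¬ x ≡ v → ¬ y ≡ v → adj G' x y ≡ (if samePair u w x y then true else adj G x y)
  adj'-≢v {x} {y} x≢v y≢v = trans (G'≡ x y) (if-cong-else (samePair u w x y)
    (if-cong (cong₂ _∨_ (samePair-≢snd {a = u} x≢v y≢v) (samePair-≢fst {b = w} x≢v y≢v))))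

  deg'-u : deg G' u ≡ deg G u
  deg'-u = count-swap v≢w
    (trans (adj-sym G' u v) (trans adj'-vu (sym uw∉G)))
    (trans adj'-uw (sym uv∈G))
    (λ y y≢v y≢w → trans (adj'-≢v u≢v y≢v) (if-cong (samePair-≢snd u≢w y≢w)))

  deg'-w : deg G' w ≡ deg G w
  deg'-w = count-swap (u≢v ∘ sym)
    (trans (adj-sym G' w v) (trans adj'-vw (sym (trans (adj-sym G w u) uw∉G))))
    (trans (adj-sym G' w u) (trans adj'-uw (sym (trans (adj-sym G w v) vw∈G))))
    (λ y y≢v y≢u → trans (adj'-≢v (v≢w ∘ sym) y≢v) (if-cong (samePair-≢fst (u≢w ∘ sym) y≢u)))

  deg'-≢v : ∀ {x} → ¬ x ≡ v → deg G' x ≡ deg G x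
  deg'-≢v {x} x≢v with x ≟ u | x ≟ w
  ... | yes refl | _        = deg'-u
  ... | no _     | yes refl = deg'-w
  ... | no x≢u   | no x≢w   = count-cong (λ y → adj'-∉ {y = y} x≢u x≢v x≢w)

  deg'-v : deg G' v + 2 ≡ deg G v
  deg'-v = begin
    deg G' v + 2
      ≡⟨ cong (deg G' v +_) (cong₂ _+_ (sum-δ (λ _ → 1) u) (sum-δ (λ _ → 1) w)) ⟨
    deg G' v + (sum (indicator ∘ (λ y → ⌊ y ≟ u ⌋)) + sum (indicator ∘ (λ y → ⌊ y ≟ w ⌋)))
      ≡⟨ cong₂ _+_ (sym (count≡sum (adj G' v))) (∑-distrib-+ (λ y → indicator ⌊ y ≟ u ⌋) (λ y → indicator ⌊ y ≟ w ⌋)) ⟨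
    sum (indicator ∘ adj G' v) + sum (λ y → indicator ⌊ y ≟ u ⌋ + indicator ⌊ y ≟ w ⌋)
      ≡⟨ ∑-distrib-+ (indicator ∘ adj G' v) (λ y → indicator ⌊ y ≟ u ⌋ + indicator ⌊ y ≟ w ⌋) ⟨
    sum (λ y → indicator (adj G' v y) + (indicator ⌊ y ≟ u ⌋ + indicator ⌊ y ≟ w ⌋))
      ≡⟨ sum-cong-≗ removed ⟩
    sum (indicator ∘ adj G v)
      ≡⟨ count≡sum (adj G v) ⟨
    deg G v ∎
    where
    open ≡-Reasoning
    removed : ∀ y → indicator (adj G' v y) + (indicator ⌊ y ≟ u ⌋ + indicator ⌊ y ≟ w ⌋) ≡ indicator (adj G v y)
    removed y with y ≟ u | y ≟ w
    ... | yes refl | yes u≡w = contradiction u≡w u≢w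
    ... | yes refl | no _     rewrite adj'-vu | adj-sym G v u | uv∈G = refl
    ... | no _     | yes refl rewrite adj'-vw | vw∈G = refl
    ... | no y≢u   | no y≢w   rewrite adj'-v y≢u y≢w = +-identityʳ _

-- Credits and debits

module CreditDebit {n} (G G' : Graph n) {u v w : Fin n}
  (uv∈F : arcF G u v ≡ true) (vw∈F : arcF G v w ≡ true) (uw∉G : adj G u w ≡ false)
  (G'≡ : ∀ x y → adj G' x y ≡ moveAdj G u v w x y) where

  uv∈G : adj G u v ≡ true
  uv∈G = proj₁ (arcF⇒ G u v uv∈F)

  vw∈G : adj G v w ≡ true
  vw∈G = proj₁ (arcF⇒ G v w vw∈F)

  dv<du : deg G v < deg G u
  dv<du = proj₂ (arcF⇒ G u v uv∈F)

  dw<dv : deg G w < deg G v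
  dw<dv = proj₂ (arcF⇒ G v w vw∈F)

  open Shortcut G G' uv∈G vw∈G uw∉G G'≡

  a b c b' D : ℕ
  a  = deg G u ^ 2
  b  = deg G v ^ 2
  c  = deg G w ^ 2
  b' = deg G' v ^ 2
  D  = b ∸ b'

  c≤b : c ≤ b
  c≤b = ^-monoˡ-≤ 2 (<⇒≤ dw<dv)

  b≤a : b ≤ a
  b≤a = ^-monoˡ-≤ 2 (<⇒≤ dv<du)

  b'<b : b' < b
  b'<b = ^-monoˡ-< 2 (subst (deg G' v <_) deg'-v (m<m+n (deg G' v) z<s))

  -- ℓ⁺ x credits the pair vx with the D it gains when x is an in-neighbour of v in F, and ℓ⁻ x
  -- debits the D it may lose when x is an out-neighbour. The arcs uv and vw are deleted instead,
  -- so the D credited at u and debited at w are cancelled by an extra D debited at u and credited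
  -- at w; the weights a − b and b − c of the deleted edges are debited at u and w and come back
  -- as the weight of the new edge uw.
  ℓ⁺ ℓ⁻ : Fin n → ℕ
  ℓ⁺ x = (if ⌊ x ≟ w ⌋ then D else 0) + (if arcF G x v then D else 0)
  ℓ⁻ x = (if ⌊ x ≟ u ⌋ then (a ∸ b) + D else 0) + (if ⌊ x ≟ w ⌋ then b ∸ c else 0) + (if arcF G v x then D else 0)

  new : Fin n → Fin n → ℕ
  new i j = if samePair u w i j then ∣ deg G i ^ 2 - deg G j ^ 2 ∣ else 0

  new-sym : ∀ i j → new i j ≡ new j i
  new-sym i j = trans (if-cong (samePair-sym u w i j)) (if-cong-then (samePair u w j i) (∣-∣-comm (deg G i ^ 2) _))

  new-∉G : ∀ {i j} → samePair u w i j ≡ true → adj G i j ≡ false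
  new-∉G {i} {j} s with samePair⇒ {a = u} {b = w} {x = i} {y = j} s
  ... | inj₁ (refl , refl) = uw∉G
  ... | inj₂ (refl , refl) = trans (adj-sym G w u) uw∉G

  row-u : weight G v u + ℓ⁺ u ≡ weight G' v u + ℓ⁻ u
  row-u = begin
    weight G v u + ℓ⁺ u      ≡⟨ cong₂ _+_ (if-cong (trans (adj-sym G v u) uv∈G)) ℓ⁺-u ⟩
    ∣ b - a ∣ + D            ≡⟨ cong (_+ D) (m≤n⇒∣m-n∣≡n∸m b≤a) ⟩
    (a ∸ b) + D              ≡⟨ cong₂ _+_ (if-cong adj'-vu) ℓ⁻-u ⟨
    weight G' v u + ℓ⁻ u     ∎
    where
    open ≡-Reasoning
    ℓ⁺-u : ℓ⁺ u ≡ D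
    ℓ⁺-u = cong₂ _+_ (if-cong (⌊⌋-false (u ≟ w) u≢w)) (if-cong uv∈F)
    ℓ⁻-u : ℓ⁻ u ≡ (a ∸ b) + D
    ℓ⁻-u = trans (cong₂ _+_ (cong₂ _+_ (if-cong (⌊⌋-true (u ≟ u) refl)) (if-cong (⌊⌋-false (u ≟ w) u≢w)))
                             (if-cong (arcF-≮ G v u (<-asym dv<du))))
                 (trans (+-identityʳ _) (+-identityʳ _))

  row-w : weight G v w + ℓ⁺ w ≡ weight G' v w + ℓ⁻ w
  row-w = begin
    weight G v w + ℓ⁺ w      ≡⟨ cong₂ _+_ (if-cong vw∈G) ℓ⁺-w ⟩
    ∣ b - c ∣ + D            ≡⟨ cong (_+ D) (m≤n⇒∣n-m∣≡n∸m c≤b) ⟩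
    (b ∸ c) + D              ≡⟨ cong₂ _+_ (if-cong adj'-vw) ℓ⁻-w ⟨
    weight G' v w + ℓ⁻ w     ∎
    where
    open ≡-Reasoning
    ℓ⁺-w : ℓ⁺ w ≡ D
    ℓ⁺-w = trans (cong₂ _+_ (if-cong (⌊⌋-true (w ≟ w) refl)) (if-cong (arcF-≮ G w v (<-asym dw<dv))))
                 (+-identityʳ D)
    ℓ⁻-w : ℓ⁻ w ≡ (b ∸ c) + D
    ℓ⁻-w = cong₂ _+_ (cong₂ _+_ (if-cong (⌊⌋-false (w ≟ u) (u≢w ∘ sym))) (if-cong (⌊⌋-true (w ≟ w) refl)))
                     (if-cong vw∈F)

  row-other : ∀ {x} → ¬ x ≡ u → ¬ x ≡ v → ¬ x ≡ w → weight G v x + ℓ⁺ x ≤ weight G' v x + ℓ⁻ x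
  row-other {x} x≢u x≢v x≢w = begin
    weight G v x + ℓ⁺ x
      ≡⟨ cong (λ t → weight G v x + (t + (if arcF G x v then D else 0))) (if-cong (⌊⌋-false (x ≟ w) x≢w)) ⟩
    weight G v x + (if arcF G x v then D else 0)
      ≡⟨ cong (weight G v x +_) (if-cong (cong (_∧ ⌊ deg G v <? deg G x ⌋) (adj-sym G x v))) ⟩
    (if adj G v x then ∣ b - deg G x ^ 2 ∣ else 0) + (if adj G v x ∧ ⌊ deg G v <? deg G x ⌋ then D else 0)
      ≤⟨ lowered-edge-weight (adj G v x) (<⇒≤ b'<b) ⟩
    (if adj G v x then ∣ b' - deg G x ^ 2 ∣ else 0) + (if arcF G v x then D else 0)
      ≡⟨ cong₂ _+_ weight'-vx ℓ⁻-x ⟨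
    weight G' v x + ℓ⁻ x ∎
    where
    open ≤-Reasoning
    weight'-vx : weight G' v x ≡ (if adj G v x then ∣ b' - deg G x ^ 2 ∣ else 0)
    weight'-vx = trans (if-cong (adj'-v x≢u x≢w))
                       (if-cong-then (adj G v x) (cong (λ d → ∣ b' - d ^ 2 ∣) (deg'-≢v x≢v)))
    ℓ⁻-x : ℓ⁻ x ≡ (if arcF G v x then D else 0)
    ℓ⁻-x = cong (_+ (if arcF G v x then D else 0))
                (cong₂ _+_ (if-cong (⌊⌋-false (x ≟ u) x≢u)) (if-cong (⌊⌋-false (x ≟ w) x≢w)))

  row : ∀ {x} → ¬ x ≡ v → weight G v x + ℓ⁺ x ≤ weight G' v x + ℓ⁻ x
  row {x} x≢v = by-cases (x ≟ u) (x ≟ w)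
    where
    by-cases : Dec (x ≡ u) → Dec (x ≡ w) → weight G v x + ℓ⁺ x ≤ weight G' v x + ℓ⁻ x
    by-cases (yes refl) _          = ≤-reflexive row-u
    by-cases (no _)     (yes refl) = ≤-reflexive row-w
    by-cases (no x≢u)   (no x≢w)   = row-other x≢u x≢v x≢w

  weight'-off-v : ∀ {i j} → ¬ i ≡ v → ¬ j ≡ v → weight G' i j ≡ weight G i j + new i j
  weight'-off-v {i} {j} i≢v j≢v = begin
    weight G' i j
      ≡⟨ if-cong (adj'-≢v i≢v j≢v) ⟩
    (if (if samePair u w i j then true else adj G i j) then ∣ deg G' i ^ 2 - deg G' j ^ 2 ∣ else 0)
      ≡⟨ if-cong-then (if samePair u w i j then true else adj G i j)
           (cong₂ (λ p q → ∣ p ^ 2 - q ^ 2 ∣) (deg'-≢v i≢v) (deg'-≢v j≢v)) ⟩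
    (if (if samePair u w i j then true else adj G i j) then ∣ deg G i ^ 2 - deg G j ^ 2 ∣ else 0)
      ≡⟨ if-disjoint-∨ (samePair u w i j) (adj G i j) new-∉G ⟩
    weight G i j + new i j ∎
    where open ≡-Reasoning

  credit debit : Fin n → Fin n → ℕ
  credit i j = star v ℓ⁺ i j + new i j
  debit = star v ℓ⁻

  pairwise-at-v : ∀ {j} → ¬ j ≡ v → weight G v j + credit v j ≤ weight G' v j + debit v j
  pairwise-at-v {j} j≢v = begin
    weight G v j + (star v ℓ⁺ v j + new v j)
      ≡⟨ cong (weight G v j +_) (cong₂ _+_ (star-centre ℓ⁺ j≢v) (if-cong (samePair-∉ (u≢v ∘ sym) v≢w))) ⟩
    weight G v j + (ℓ⁺ j + 0)
      ≡⟨ cong (weight G v j +_) (+-identityʳ (ℓ⁺ j)) ⟩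
    weight G v j + ℓ⁺ j
      ≤⟨ row j≢v ⟩
    weight G' v j + ℓ⁻ j
      ≡⟨ cong (weight G' v j +_) (star-centre ℓ⁻ j≢v) ⟨
    weight G' v j + debit v j ∎
    where open ≤-Reasoning

  pairwise-off-v : ∀ {i j} → ¬ i ≡ v → ¬ j ≡ v → weight G i j + credit i j ≡ weight G' i j + debit i j
  pairwise-off-v {i} {j} i≢v j≢v = begin
    weight G i j + (star v ℓ⁺ i j + new i j)   ≡⟨ cong (λ t → weight G i j + (t + new i j)) (star-away ℓ⁺ i≢v j≢v) ⟩
    weight G i j + new i j                     ≡⟨ weight'-off-v i≢v j≢v ⟨
    weight G' i j                              ≡⟨ +-identityʳ (weight G' i j) ⟨
    weight G' i j + 0                          ≡⟨ cong (weight G' i j +_) (star-away ℓ⁻ i≢v j≢v) ⟨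
    weight G' i j + debit i j                  ∎
    where open ≡-Reasoning

  pairwise : ∀ {i j} → ¬ i ≡ j → weight G i j + credit i j ≤ weight G' i j + debit i j
  pairwise {i} {j} i≢j = by-cases (i ≟ v) (j ≟ v)
    where
    by-cases : Dec (i ≡ v) → Dec (j ≡ v) → weight G i j + credit i j ≤ weight G' i j + debit i j
    by-cases (yes refl) (yes refl) = contradiction refl i≢j
    by-cases (yes refl) (no j≢v)   = pairwise-at-v j≢v
    by-cases (no i≢v)   (yes refl) = subst₂ _≤_
      (cong₂ _+_ (weight-sym G v i) (cong₂ _+_ (star-sym v ℓ⁺ v i) (new-sym v i)))
      (cong₂ _+_ (weight-sym G' v i) (star-sym v ℓ⁻ v i))
      (pairwise-at-v i≢v)
    by-cases (no i≢v)   (no j≢v)   = ≤-reflexive (pairwise-off-v i≢v j≢v)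

  ℓ⁺-v : ℓ⁺ v ≡ 0
  ℓ⁺-v = cong₂ _+_ (if-cong (⌊⌋-false (v ≟ w) v≢w)) (if-cong (arcF-≮ G v v (n≮n _)))

  ℓ⁻-v : ℓ⁻ v ≡ 0
  ℓ⁻-v = cong₂ _+_ (cong₂ _+_ (if-cong (⌊⌋-false (v ≟ u) (u≢v ∘ sym))) (if-cong (⌊⌋-false (v ≟ w) v≢w)))
                   (if-cong (arcF-≮ G v v (n≮n _)))

  uw≤pairSum-new : ∣ a - c ∣ ≤ pairSum new
  uw≤pairSum-new = subst (_≤ pairSum new) (if-cong (samePair-refl u w)) (≢⇒≤-pairSum new new-sym u≢w)

  cM2+credit≤cM2'+debit : cM2 G + (sum ℓ⁺ + ∣ a - c ∣) ≤ cM2 G' + sum ℓ⁻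
  cM2+credit≤cM2'+debit = begin
    cM2 G + (sum ℓ⁺ + ∣ a - c ∣)
      ≤⟨ +-mono-≤ (≤-reflexive (cM2≡pairSum G)) (+-monoˡ-≤ _ (≤-reflexive (sym (pairSum-star v ℓ⁺ ℓ⁺-v)))) ⟩
    pairSum (weight G) + (pairSum (star v ℓ⁺) + ∣ a - c ∣)
      ≤⟨ +-monoʳ-≤ (pairSum (weight G)) (+-monoʳ-≤ (pairSum (star v ℓ⁺)) uw≤pairSum-new) ⟩
    pairSum (weight G) + (pairSum (star v ℓ⁺) + pairSum new)
      ≡⟨ cong (pairSum (weight G) +_) (pairSum-+ (star v ℓ⁺) new) ⟨
    pairSum (weight G) + pairSum credit
      ≡⟨ pairSum-+ (weight G) credit ⟨
    pairSum (λ i j → weight G i j + credit i j)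
      ≤⟨ pairSum-mono-≤ (λ i<j → pairwise (<⇒≢ i<j ∘ cong toℕ)) ⟩
    pairSum (λ i j → weight G' i j + debit i j)
      ≡⟨ pairSum-+ (weight G') debit ⟩
    pairSum (weight G') + pairSum debit
      ≡⟨ cong₂ _+_ (sym (cM2≡pairSum G')) (pairSum-star v ℓ⁻ ℓ⁻-v) ⟩
    cM2 G' + sum ℓ⁻ ∎
    where open ≤-Reasoning

  sum-ℓ⁺ : sum ℓ⁺ ≡ D + D * indegF G v
  sum-ℓ⁺ = trans (∑-distrib-+ (λ x → if ⌊ x ≟ w ⌋ then D else 0) (λ x → if arcF G x v then D else 0))
                 (cong₂ _+_ (sum-δ (λ _ → D) w) (sum-if≡*count (λ x → arcF G x v) D))

  sum-ℓ⁻ : sum ℓ⁻ ≡ (a ∸ b) + D + (b ∸ c) + D * outdegF G v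
  sum-ℓ⁻ = trans (∑-distrib-+ (λ x → (if ⌊ x ≟ u ⌋ then (a ∸ b) + D else 0) + (if ⌊ x ≟ w ⌋ then b ∸ c else 0))
                               (λ x → if arcF G v x then D else 0))
                 (cong₂ _+_ (trans (∑-distrib-+ (λ x → if ⌊ x ≟ u ⌋ then (a ∸ b) + D else 0)
                                                (λ x → if ⌊ x ≟ w ⌋ then b ∸ c else 0))
                                   (cong₂ _+_ (sum-δ (λ _ → (a ∸ b) + D) u) (sum-δ (λ _ → b ∸ c) w)))
                            (sum-if≡*count (λ x → arcF G v x) D))

  debit<credit : InY G v → sum ℓ⁻ < sum ℓ⁺ + ∣ a - c ∣
  debit<credit v∈Y = begin-strict
    sum ℓ⁻                                     ≡⟨ sum-ℓ⁻ ⟩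
    (a ∸ b) + D + (b ∸ c) + D * outdegF G v    <⟨ +-monoʳ-< ((a ∸ b) + D + (b ∸ c)) (*-monoʳ-< D v∈Y) ⟩
    (a ∸ b) + D + (b ∸ c) + D * indegF G v     ≡⟨ rearrange (a ∸ b) D (b ∸ c) (D * indegF G v) ⟩
    D + D * indegF G v + ((a ∸ b) + (b ∸ c))   ≡⟨ cong₂ _+_ sum-ℓ⁺ a-c≡a-b+b-c ⟨
    sum ℓ⁺ + ∣ a - c ∣                         ∎
    where
    open ≤-Reasoning
    instance
      D≢0 : NonZero D
      D≢0 = >-nonZero (m<n⇒0<n∸m b'<b)
    rearrange : ∀ x y z t → x + y + z + t ≡ y + t + (x + z)
    rearrange = solve-∀
    a-c≡a-b+b-c : ∣ a - c ∣ ≡ (a ∸ b) + (b ∸ c)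
    a-c≡a-b+b-c = trans (m≤n⇒∣n-m∣≡n∸m (≤-trans c≤b b≤a)) (sym (m∸n+n∸o≡m∸o c≤b b≤a))

mainTheorem3 : ∀ {n} (G : Graph n) (u v w : Fin n)
    → InY G v
    → arcF G u v ≡ true
    → arcF G v w ≡ true
    → adj G u w ≡ false
    → (G' : Graph n)
    → (∀ x y → adj G' x y ≡ moveAdj G u v w x y)
    → cM2 G < cM2 G'
mainTheorem3 G u v w v∈Y uv∈F vw∈F uw∉G G' G'≡ =
  +-cancelʳ-< (sum ℓ⁺ + ∣ a - c ∣) (cM2 G) (cM2 G') (begin-strict
    cM2 G + (sum ℓ⁺ + ∣ a - c ∣)    ≤⟨ cM2+credit≤cM2'+debit ⟩
    cM2 G' + sum ℓ⁻                 <⟨ +-monoʳ-< (cM2 G') (debit<credit v∈Y) ⟩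
    cM2 G' + (sum ℓ⁺ + ∣ a - c ∣)   ∎)
  where
  open CreditDebit G G' uv∈F vw∈F uw∉G G'≡
  open ≤-Reasoning
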